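{- Let $S$ be a type-space functor. The map $\sigma\mapsto M_\sigma$ is a bijection between $S_{\mathcal W}$ and the set of models of size $\omega$ for $S$, with inverse $M\mapsto\sigma_M$.
   Context: Regard each natural number $n$ as the set $\{0,\dots,n-1\}$. A type-space functor $S$ assigns to each $n<\omega$ a topological space $S_n$ and to each function $f:n\to m$ a continuous open map $Sf:S_m\to S_n$ such that $S(g\circ f)=(Sf)\circ(Sg)$, $S(\mathrm{id}_n)=\mathrm{id}_{S_n}$, and a weak amalgamation condition holds (for every $m$, $p\in S_m$, $q\in(Si_m)^{ -1}(\{p\})$ and non-empty open $U\subseteq(Si_m)^{ -1}(\{p\})$ there is $r\in S_{m+2}$ with $(Si_{m+1})(r)=q$ and $(Sd_m)(r)\in U$, where $i_k:k\to k+1$ is the inclusion and $d_m(j)=j$ for $j<m$, $d_m(m)=m+1$). For $n\le m$, $\iota_{n,m}:n\to m$ is the inclusion. $S_\omega=\{(a_n)_{n<\omega}\in\prod_n S_n : a_n=(S\iota_{n,m})(a_m)\ \forall n<m\}$ with the product subspace topology. For $f:n\to\omega$ define $Sf:S_\omega\to S_n$ by picking $m$ with $f[n]\subseteq m$, letting $f':n\to m$ agree with $f$, and setting $(Sf)((a_j)_{j})=(Sf')(a_m)$. A model of size $\kappa$ for $S$ is a function $M$ with domain $[\kappa]^{<\omega}$ such that for every $A=\{a_0<\dots<a_{n-1}\}\in[\kappa]^n$: (1) $M(A)\in S_n$; (2) if $B=\{b_0<\dots<b_{m-1}\}\in[\kappa]^m$, $A\subseteq B$ and $g:n\to m$ satisfies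 $a_i=b_{g(i)}$ for all $i$, then $M(A)=(Sg)(M(B))$; (3) for every $m\ge n$ and every open $U\subseteq(S\iota_{n,m})^{ -1}(\{M(A)\})$ there are $B=\{b_0<\dots<b_{m-1}\}\in[\kappa]^m$ with $A\subseteq B$ and a permutation $g$ of $m$ with $a_i=b_{g(i)}$ for all $i<n$ and $(Sg)(M(B))\in U$. For $\sigma\in S_\omega$ and $A\in[\omega]^n$, let $f_A:n\to\omega$ send $i$ to the $i$-th element of $A$ in increasing order and set $M_\sigma(A)=(Sf_A)(\sigma)$. $S_{\mathcal W}$ is the set of $\sigma\in S_\omega$ such that $M_\sigma$ is a model of size $\omega$. For a model $M$ of size $\omega$, $\sigma_M=(\sigma_n)_{n<\omega}$ where $\sigma_n=M(\{0,1,\dots,n-1\})$. -}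

module Defs where

open import Level using (Level; 0ℓ) renaming (suc to lsuc)
open import Data.Nat using (ℕ; zero; suc; _<_; _≤_; _⊔_; s≤s; z≤n)
open import Data.Nat.Properties using (m≤m⊔n; m≤n⊔m; <-≤-trans; <⇒≤; ≤-refl)
open import Data.Fin using (Fin; zero; suc; inject₁; inject≤; fromℕ<)
open import Data.Fin.Permutation using (Permutation′; _⟨$⟩ʳ_)
open import Data.Vec using (Vec; []; _∷_; lookup)
open import Data.Vec.Relation.Unary.Linked using (Linked; []; [-]; _∷_)
open import Data.Product using (Σ; ∃; _×_; _,_; proj₁; proj₂)
open import Data.Unit using () renaming (⊤ to ⊤′)
open import Function using (_∘_; id)
open import Relation.Binary.PropositionalEquality using (_≡_; refl)

record Space : Set₁ where
  field
    Carrier : Set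
    IsOpen  : (Carrier → Set) → Set
    open-whole : IsOpen (λ _ → ⊤′)
    open-∩     : ∀ {U V} → IsOpen U → IsOpen V → IsOpen (λ x → U x × V x)
    open-⋃     : (I : Set) (U : I → Carrier → Set) →
                 (∀ i → IsOpen (U i)) → IsOpen (λ x → Σ I (λ i → U i x))
    open-ext   : ∀ {U V} → (∀ x → U x → V x) → (∀ x → V x → U x) →
                 IsOpen U → IsOpen V
open Space public

IsOpenIn : (X : Space) → (Carrier X → Set) → (Carrier X → Set) → Set₁
IsOpenIn X F U =
  Σ (Carrier X → Set) λ V → IsOpen X V ×
    ((∀ x → U x → V x × F x) × (∀ x → V x × F x → U x))

Continuous : (X Y : Space) → (Carrier X → Carrier Y) → Set₁
Continuous X Y f = ∀ (V : Carrier Y → Set) → IsOpen Y V → IsOpen X (V ∘ f)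

IsOpenMap : (X Y : Space) → (Carrier X → Carrier Y) → Set₁
IsOpenMap X Y f = ∀ (U : Carrier X → Set) → IsOpen X U →
  IsOpen Y (λ y → ∃ λ x → U x × f x ≡ y)

i : (k : ℕ) → Fin k → Fin (suc k)
i k = inject₁

-- d_m(j) = j for j < m, d_m(m) = m+1
d : (m : ℕ) → Fin (suc m) → Fin (suc (suc m))
d zero    zero    = suc zero
d (suc m) zero    = zero
d (suc m) (suc j) = suc (d m j)

ι : (n m : ℕ) → n ≤ m → Fin n → Fin m
ι n m h x = inject≤ x h

record TypeSpaceFunctor : Set₁ where
  field
    S    : ℕ → Space
    map  : ∀ {n m} → (Fin n → Fin m) → Carrier (S m) → Carrier (S n)
    map-cong : ∀ {n m} (f g : Fin n → Fin m) → (∀ x → f x ≡ g x) →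
               ∀ p → map f p ≡ map g p
    map-cont : ∀ {n m} (f : Fin n → Fin m) → Continuous (S m) (S n) (map f)
    map-open : ∀ {n m} (f : Fin n → Fin m) → IsOpenMap (S m) (S n) (map f)
    map-∘    : ∀ {n m k} (f : Fin n → Fin m) (g : Fin m → Fin k) →
               ∀ p → map (g ∘ f) p ≡ map f (map g p)
    map-id   : ∀ {n} p → map {n} {n} id p ≡ p
    amalg : ∀ m (p : Carrier (S m)) (q : Carrier (S (suc m))) →
            map (i m) q ≡ p →
            (U : Carrier (S (suc m)) → Set) →
            IsOpenIn (S (suc m)) (λ x → map (i m) x ≡ p) U →
            (∃ λ x → U x) →
            ∃ λ (r : Carrier (S (suc (suc m)))) →
              map (i (suc m)) r ≡ q × U (map (d m) r)

module _ (T : TypeSpaceFunctor) where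
  open TypeSpaceFunctor T

  -- S_ω (as a set; its topology is not needed here)

  Coherent : ((n : ℕ) → Carrier (S n)) → Set
  Coherent a = ∀ n m → (h : n < m) → a n ≡ map (ι n m (<⇒≤ h)) (a m)

  Sω : Set
  Sω = Σ ((n : ℕ) → Carrier (S n)) Coherent

  bound : ∀ {n} → (Fin n → ℕ) → ℕ
  bound {zero}  f = zero
  bound {suc n} f = suc (f zero) ⊔ bound (f ∘ suc)

  bound-< : ∀ {n} (f : Fin n → ℕ) (x : Fin n) → f x < bound f
  bound-< {suc n} f zero    = m≤m⊔n (suc (f zero)) (bound (f ∘ suc))
  bound-< {suc n} f (suc x) =
    <-≤-trans (bound-< (f ∘ suc) x) (m≤n⊔m (suc (f zero)) (bound (f ∘ suc)))

  mapω : ∀ {n} → (Fin n → ℕ) → Sω → Carrier (S n)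
  mapω f σ = map (λ x → fromℕ< (bound-< f x)) (proj₁ σ (bound f))

  -- [ω]^n : strictly increasing vectors a_0 < … < a_{n-1}

  FinSub : ℕ → Set
  FinSub n = Σ (Vec ℕ n) (Linked _<_)

  elem : ∀ {n} → FinSub n → Fin n → ℕ
  elem A = lookup (proj₁ A)

  -- a candidate model of size ω: condition (1) is built into the type
  PreModel : Set
  PreModel = ∀ {n} → FinSub n → Carrier (S n)

  IsModel : PreModel → Set₁
  IsModel M =
    (∀ {n m} (A : FinSub n) (B : FinSub m) (g : Fin n → Fin m) →
       (∀ x → elem A x ≡ elem B (g x)) → M A ≡ map g (M B))
    ×
    (∀ {n} (A : FinSub n) m (h : n ≤ m) (U : Carrier (S m) → Set) →
       IsOpenIn (S m) (λ x → map (ι n m h) x ≡ M A) U →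
       (∃ λ x → U x) →
       ∃ λ (B : FinSub m) → ∃ λ (g : Permutation′ m) →
         (∀ x → elem A x ≡ elem B (g ⟨$⟩ʳ ι n m h x)) ×
         U (map (g ⟨$⟩ʳ_) (M B)))

  Model : Set₁
  Model = Σ PreModel IsModel

  Mσ : Sω → PreModel
  Mσ σ A = mapω (elem A) σ

  InSW : Sω → Set₁
  InSW σ = IsModel (Mσ σ)

  ivec : (k n : ℕ) → Vec ℕ n
  ivec k zero    = []
  ivec k (suc n) = k ∷ ivec (suc k) n

  ilinked : (k n : ℕ) → Linked _<_ (ivec k n)
  ilinked k zero          = []
  ilinked k (suc zero)    = [-]
  ilinked k (suc (suc n)) = ≤-refl ∷ ilinked (suc k) (suc n)

  interval : (k n : ℕ) → FinSub n
  interval k n = ivec k n , ilinked k n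

  σseq : PreModel → (n : ℕ) → Carrier (S n)
  σseq M n = M (interval 0 n)

-- Both composites are identities because S f on S_ω may be evaluated at any level m bounding the
-- image of f (coherence of σ together with functoriality), and because a model is determined by
-- its values on the initial segments {0,…,n-1}: condition (2), applied to A ⊆ {0,…,m-1}, gives
-- M(A) = (S g)(σ_M)_m.  Hence σ_{M_σ} = σ and M_{σ_M} = M; the latter also shows that σ_M is
-- coherent and that M_{σ_M} is a model, i.e. σ_M ∈ S_W.
module Submission where

open import Defs
open import Data.Nat using (ℕ; zero; suc; _+_; _<_; _≤_)
open import Data.Nat.Properties using (≤-total; m≤n⇒m<n∨m≡n; +-suc; +-identityʳ; <⇒≤)
open import Data.Fin using (Fin; toℕ; fromℕ<; inject≤; zero; suc)
open import Data.Fin.Properties using (toℕ-injective; toℕ-fromℕ<; toℕ-inject≤; toℕ<n)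
open import Data.Vec using (lookup)
open import Data.Fin.Permutation using (Permutation′; _⟨$⟩ʳ_)
open import Data.Sum using (inj₁; inj₂)
open import Function using (_∘_)
open import Data.Product using (Σ; ∃; _×_; _,_; proj₁; proj₂)
open import Relation.Binary.PropositionalEquality
  using (_≡_; refl; sym; trans; cong; subst; module ≡-Reasoning)

module _ (T : TypeSpaceFunctor) where
  open TypeSpaceFunctor T

  map-cong-toℕ : ∀ {n m} (f g : Fin n → Fin m) → (∀ x → toℕ (f x) ≡ toℕ (g x)) →
                 ∀ p → map f p ≡ map g p
  map-cong-toℕ f g e = map-cong f g (λ x → toℕ-injective (e x))

  lookup-ivec : ∀ k n (x : Fin n) → lookup (ivec T k n) x ≡ k + toℕ x
  lookup-ivec k (suc n) zero    = sym (+-identityʳ k)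
  lookup-ivec k (suc n) (suc x) = trans (lookup-ivec (suc k) n x) (sym (+-suc k (toℕ x)))

  elem-interval₀ : ∀ n (x : Fin n) → elem T (interval T 0 n) x ≡ toℕ x
  elem-interval₀ = lookup-ivec 0

  mapAt : Sω T → ∀ {n} (f : Fin n → ℕ) m → (∀ x → f x < m) → Carrier (S n)
  mapAt σ f m f<m = map (λ x → fromℕ< (f<m x)) (proj₁ σ m)

  mapAt-mono : (σ : Sω T) → ∀ {n} (f : Fin n → ℕ) {m m'} → m ≤ m' →
               (f<m : ∀ x → f x < m) (f<m' : ∀ x → f x < m') →
               mapAt σ f m f<m ≡ mapAt σ f m' f<m'
  mapAt-mono σ {n} f {m} {m'} m≤m' f<m f<m' with m≤n⇒m<n∨m≡n m≤m'
  ... | inj₂ refl = map-cong-toℕ _ _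
          (λ x → trans (toℕ-fromℕ< (f<m x)) (sym (toℕ-fromℕ< (f<m' x)))) _
  ... | inj₁ m<m' = begin
    map to-m (proj₁ σ m)                              ≡⟨ cong (map to-m) (proj₂ σ m m' m<m') ⟩
    map to-m (map (ι m m' (<⇒≤ m<m')) (proj₁ σ m'))   ≡⟨ sym (map-∘ to-m _ (proj₁ σ m')) ⟩
    map (ι m m' (<⇒≤ m<m') ∘ to-m) (proj₁ σ m')
      ≡⟨ map-cong-toℕ _ _ same-value (proj₁ σ m') ⟩
    map (λ x → fromℕ< (f<m' x)) (proj₁ σ m')          ∎
    where
    open ≡-Reasoning
    to-m : Fin n → Fin m
    to-m x = fromℕ< (f<m x)
    same-value : ∀ x → toℕ (inject≤ (to-m x) (<⇒≤ m<m')) ≡ toℕ (fromℕ< (f<m' x))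
    same-value x = trans (toℕ-inject≤ (to-m x) (<⇒≤ m<m'))
                     (trans (toℕ-fromℕ< (f<m x)) (sym (toℕ-fromℕ< (f<m' x))))

  mapω-at : (σ : Sω T) → ∀ {n} (f : Fin n → ℕ) m (f<m : ∀ x → f x < m) →
            mapω T f σ ≡ mapAt σ f m f<m
  mapω-at σ f m f<m with ≤-total (bound T f) m
  ... | inj₁ b≤m = mapAt-mono σ f b≤m (bound-< T f) f<m
  ... | inj₂ m≤b = sym (mapAt-mono σ f m≤b f<m (bound-< T f))

  σseq-Mσ : (σ : Sω T) (n : ℕ) → σseq T (Mσ T σ) n ≡ proj₁ σ n
  σseq-Mσ σ n = begin
    mapω T (elem T (interval T 0 n)) σ            ≡⟨ mapω-at σ _ n elem<n ⟩
    map (λ x → fromℕ< (elem<n x)) (proj₁ σ n)   ≡⟨ map-cong-toℕ _ _ is-id (proj₁ σ n) ⟩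
    map (λ x → x) (proj₁ σ n)                   ≡⟨ map-id (proj₁ σ n) ⟩
    proj₁ σ n                                   ∎
    where
    open ≡-Reasoning
    elem<n : ∀ x → elem T (interval T 0 n) x < n
    elem<n x = subst (_< n) (sym (elem-interval₀ n x)) (toℕ<n x)
    is-id : ∀ x → toℕ (fromℕ< (elem<n x)) ≡ toℕ x
    is-id x = trans (toℕ-fromℕ< (elem<n x)) (elem-interval₀ n x)

  σseq-coherent : (M : Model T) → Coherent T (σseq T (proj₁ M))
  σseq-coherent (M , restrict , _) n m n<m =
    restrict (interval T 0 n) (interval T 0 m) _ same-elem
    where
    same-elem : ∀ x → elem T (interval T 0 n) x
                    ≡ elem T (interval T 0 m) (ι n m (<⇒≤ n<m) x)
    same-elem x = trans (elem-interval₀ n x)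
                    (sym (trans (elem-interval₀ m _) (toℕ-inject≤ x (<⇒≤ n<m))))

  Mσ-σseq : (M : Model T) (c : Coherent T (σseq T (proj₁ M))) →
            ∀ {n} (A : FinSub T n) → Mσ T (σseq T (proj₁ M) , c) A ≡ proj₁ M A
  Mσ-σseq (M , restrict , _) c {n} A =
    sym (restrict A (interval T 0 _) into-bound same-elem)
    where
    into-bound : Fin n → Fin (bound T (elem T A))
    into-bound x = fromℕ< (bound-< T (elem T A) x)
    same-elem : ∀ x → elem T A x ≡ elem T (interval T 0 _) (into-bound x)
    same-elem x = sym (trans (elem-interval₀ _ (into-bound x))
                        (toℕ-fromℕ< (bound-< T (elem T A) x)))

  IsModel-resp : (M M' : PreModel T) → (∀ {n} (A : FinSub T n) → M' A ≡ M A) →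
                 IsModel T M → IsModel T M'
  IsModel-resp M M' M'≡M (restrict , realise) = restrict' , realise'
    where
    restrict' : ∀ {n m} (A : FinSub T n) (B : FinSub T m) (g : Fin n → Fin m) →
                (∀ x → elem T A x ≡ elem T B (g x)) → M' A ≡ map g (M' B)
    restrict' A B g e rewrite M'≡M A | M'≡M B = restrict A B g e
    realise' : ∀ {n} (A : FinSub T n) m (h : n ≤ m) (U : Carrier (S m) → Set) →
               IsOpenIn (S m) (λ x → map (ι n m h) x ≡ M' A) U → (∃ λ x → U x) →
               ∃ λ (B : FinSub T m) → ∃ λ (g : Permutation′ m) →
                 (∀ x → elem T A x ≡ elem T B (g ⟨$⟩ʳ ι n m h x)) ×
                 U (map (g ⟨$⟩ʳ_) (M' B))
    realise' A m h U open-U inhabited-U rewrite M'≡M A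
      with realise A m h U open-U inhabited-U
    ... | B , g , same-elem , in-U =
      B , g , same-elem , subst (λ p → U (map (g ⟨$⟩ʳ_) p)) (sym (M'≡M B)) in-U

lemma2p2 : (T : TypeSpaceFunctor) →
    ((σ : Sω T) → InSW T σ → IsModel T (Mσ T σ))
    × ((M : Model T) → Σ (Coherent T (σseq T (proj₁ M))) λ c →
         InSW T (σseq T (proj₁ M) , c))
    × ((σ : Sω T) → InSW T σ → (n : ℕ) → σseq T (Mσ T σ) n ≡ proj₁ σ n)
    × ((M : Model T) (c : Coherent T (σseq T (proj₁ M))) →
         (n : ℕ) (A : FinSub T n) → Mσ T (σseq T (proj₁ M) , c) A ≡ proj₁ M A)
lemma2p2 T =
    (λ σ σ∈SW → σ∈SW)
  , (λ M → σseq-coherent T M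
         , IsModel-resp T (proj₁ M) _ (Mσ-σseq T M (σseq-coherent T M)) (proj₂ M))
  , (λ σ _ → σseq-Mσ T σ)
  , (λ M c n → Mσ-σseq T M c)
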